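{- Let $\Gamma,\Delta$ be finite sets of formulas in $For_1$ with $\Gamma\cup\Delta$ nonempty. If $\vDash_{\mathbf{H}_3}\Gamma\Rightarrow\Delta$, then $\Gamma\Rightarrow\Delta$ is provable in $\mathbf{H}$ without using the Cut rule. In particular, for every finite set $\Gamma\cup\{\alpha\}\subseteq For_1$, if $\Gamma\vDash_{\mathbf{H}_3}\alpha$ then $\Gamma\Rightarrow\alpha$ is provable in $\mathbf{H}$.
   Context: Fix a denumerable set $prop$ of propositional variables. $For_1$ is the set of formulas built from $prop$ with a unary connective $\lnot$ and a binary connective $\vee$. $var(\alpha)$ is the set of propositional variables in $\alpha$; $var(\Gamma)=\bigcup_{\gamma\in\Gamma}var(\gamma)$. A sequent $\Gamma\Rightarrow\Delta$ is an ordered pair of finite sets of formulas, not both empty; $\alpha,\Gamma$ denotes $\Gamma\cup\{\alpha\}$. The calculus $\mathbf{H}$ has the axiom $\alpha\Rightarrow\alpha$ and the rules (premises / conclusion): (W$\Rightarrow$) $\Gamma\Rightarrow\Delta$ / $\alpha,\Gamma\Rightarrow\Delta$; ($\Rightarrow$W) $\Gamma\Rightarrow\Delta$ / $\Gamma\Rightarrow\Delta,\alpha$; (Cut) $\Gamma\Rightarrow\Delta,\alpha$ and $\alpha,\Gamma\Rightarrow\Delta$ / $\Gamma\Rightarrow\Delta$; ($\Rightarrow\lnot$) $\alpha,\Gamma\Rightarrow\Delta$ / $\Gamma\Rightarrow\Delta,\lnot\alpha$; ($\lnot^H\Rightarrow$) $\Gamma\Rightarrow\Delta,\alpha$ / $\lnot\alpha,\Gamma\Rightarrow\Delta$,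 allowed only if $var(\alpha)\subseteq var(\Delta)$; ($\vee\Rightarrow$) $\alpha_1,\Gamma\Rightarrow\Delta$ and $\alpha_2,\Gamma\Rightarrow\Delta$ / $\alpha_1\vee\alpha_2,\Gamma\Rightarrow\Delta$; ($\Rightarrow\vee$) $\Gamma\Rightarrow\Delta,\alpha_1,\alpha_2$ / $\Gamma\Rightarrow\Delta,\alpha_1\vee\alpha_2$. Halldén's logic $\mathbf{H}_3$ on $For_1$: truth values $\{1,\tfrac12,0\}$, designated set $\{1,\tfrac12\}$; valuations map $prop$ to $\{1,\tfrac12,0\}$ and extend by $\lnot 1=0,\lnot\tfrac12=\tfrac12,\lnot0=1$, and $x\vee y=\tfrac12$ if $x=\tfrac12$ or $y=\tfrac12$, otherwise classical disjunction. $\vDash_{\mathbf{H}_3}\Gamma\Rightarrow\Delta$ means: for every valuation $v$, if $v(\gamma)$ is designated for all $\gamma\in\Gamma$ then $v(\delta)$ is designated for some $\delta\in\Delta$. $\Gamma\vDash_{\mathbf{H}_3}\alpha$ means every valuation designating all of $\Gamma$ designates $\alpha$. -}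

module Defs where

open import Data.Nat using (ℕ)
open import Data.Bool using (Bool; true; false)
open import Data.List using (List; []; _∷_; _++_; concatMap)
open import Data.List.Membership.Propositional using (_∈_)
open import Data.Product using (_×_; Σ; ∃)
open import Data.Sum using (_⊎_)
open import Relation.Binary.PropositionalEquality using (_≡_)
open import Data.Empty using (⊥)
open import Data.Unit using (⊤)

Prop : Set
Prop = ℕ

data Form : Set where
  var : Prop → Form
  ¬'_ : Form → Form
  _∨'_ : Form → Form → Form

vars : Form → List Prop
vars (var p) = p ∷ []
vars (¬' a) = vars a
vars (a ∨' b) = vars a ++ vars b

varsL : List Form → List Prop
varsL = concatMap vars

-- Finite sets of formulas are represented by lists, considered up to
-- having the same members (so order and repetitions are irrelevant).
_≋_ : List Form → List Form → Set
A ≋ B = ∀ x → (x ∈ A → x ∈ B) × (x ∈ B → x ∈ A)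

_⊆v_ : List Prop → List Prop → Set
xs ⊆v ys = ∀ {p} → p ∈ xs → p ∈ ys

NonEmpty : List Form → Set
NonEmpty xs = ∃ λ x → x ∈ xs

-- The Bool index says whether Cut may be used:
-- H⊢ false Γ Δ  = derivable without Cut;  H⊢ true Γ Δ = derivable in H.
-- Each conclusion is given up to set equality (≋), so that "α,Γ" is Γ ∪ {α}.
data H⊢ (c : Bool) : List Form → List Form → Set where
  ax   : ∀ {Γ Δ} α → Γ ≋ (α ∷ []) → Δ ≋ (α ∷ []) → H⊢ c Γ Δ
  W⇒   : ∀ {Γ Δ Γ'} α → H⊢ c Γ Δ → Γ' ≋ (α ∷ Γ) → H⊢ c Γ' Δ
  ⇒W   : ∀ {Γ Δ Δ'} α → H⊢ c Γ Δ → Δ' ≋ (α ∷ Δ) → H⊢ c Γ Δ'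
  cut  : c ≡ true → ∀ {Γ Δ} α → NonEmpty (Γ ++ Δ) →
         H⊢ c Γ (α ∷ Δ) → H⊢ c (α ∷ Γ) Δ → H⊢ c Γ Δ
  ⇒¬   : ∀ {Γ Δ Δ'} α → H⊢ c (α ∷ Γ) Δ → Δ' ≋ ((¬' α) ∷ Δ) → H⊢ c Γ Δ'
  ¬H⇒  : ∀ {Γ Δ Γ'} α → vars α ⊆v varsL Δ →
         H⊢ c Γ (α ∷ Δ) → Γ' ≋ ((¬' α) ∷ Γ) → H⊢ c Γ' Δ
  ∨⇒   : ∀ {Γ Δ Γ'} α₁ α₂ → H⊢ c (α₁ ∷ Γ) Δ → H⊢ c (α₂ ∷ Γ) Δ →
         Γ' ≋ ((α₁ ∨' α₂) ∷ Γ) → H⊢ c Γ' Δ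
  ⇒∨   : ∀ {Γ Δ Δ'} α₁ α₂ → H⊢ c Γ (α₁ ∷ α₂ ∷ Δ) →
         Δ' ≋ ((α₁ ∨' α₂) ∷ Δ) → H⊢ c Γ Δ'

data V : Set where
  one half zero : V

Designated : V → Set
Designated zero = ⊥
Designated _ = ⊤

negV : V → V
negV one = zero
negV half = half
negV zero = one

orV : V → V → V
orV half _ = half
orV _ half = half
orV one _ = one
orV zero y = y

Valuation : Set
Valuation = Prop → V

eval : Valuation → Form → V
eval v (var p) = v p
eval v (¬' a) = negV (eval v a)
eval v (a ∨' b) = orV (eval v a) (eval v b)

ValidSeq : List Form → List Form → Set
ValidSeq Γ Δ = ∀ (v : Valuation) →
  (∀ {γ} → γ ∈ Γ → Designated (eval v γ)) →
  ∃ λ δ → δ ∈ Δ × Designated (eval v δ)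

Conseq : List Form → Form → Set
Conseq Γ α = ∀ (v : Valuation) →
  (∀ {γ} → γ ∈ Γ → Designated (eval v γ)) → Designated (eval v α)

module Submission where

-- Fix a list E of formulas.  Decomposing a sequent
-- Γ ⇒ Δ by the (invertible) logical rules, while keeping E as an inert extra
-- right context, either yields a cut-free derivation of Γ ⇒ Δ , E or a
-- two-valued valuation making Γ true and Δ false.  If every formula met has
-- its variables in var(E), the side condition of (¬H⇒) always holds, because
-- E stays on the right.  Termination is by the number of symbols.
--
-- Let Γ' be the formulas of Γ whose variables lie in var(Δ), and
-- search on Γ' ⇒ Δ with E = Δ.  A derivation of Γ' ⇒ Δ , Δ weakens to one of
-- Γ ⇒ Δ.  A classical refutation b of Γ' ⇒ Δ extends to an H3 valuation that
-- sends the variables outside var(Δ) to ½: the value ½ is absorbing, so every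
-- formula of Γ outside Γ' becomes designated, while the formulas of Γ' keep
-- value 1 and those of Δ value 0 — contradicting H3-validity of Γ ⇒ Δ.
-- The consequence-relation version follows with Δ = α.

open import Defs
open import Data.Bool using (Bool; true; false; not; _∨_)
open import Data.Bool.Properties using (∨-zeroʳ)
open import Data.Nat using (ℕ; zero; suc; _+_; _<_; s≤s)
open import Data.Nat.Properties
  using (≤-refl; ≤-reflexive; <-≤-trans; +-assoc; +-comm; m≤m+n; m≤n+m; +-monoˡ-≤; +-monoʳ-<)
import Data.Nat as ℕ
open import Data.List using (List; []; _∷_; _++_; map; filter)
open import Data.List.Membership.Propositional using (_∈_; lose; find)
open import Data.List.Membership.Propositional.Properties
  using (∈-++⁺ˡ; ∈-++⁺ʳ; ∈-++⁻; ∈-map⁺; ∈-concatMap⁺; ∈-concatMap⁻; ∈-filter⁺; ∈-filter⁻)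
open import Data.List.Membership.DecPropositional ℕ._≟_ using (_∈?_)
open import Data.List.Relation.Binary.Subset.Propositional using (_⊆_)
open import Data.List.Relation.Binary.Subset.Propositional.Properties
  using (Any-resp-⊆; ⊆-reflexive-↭)
open import Data.List.Relation.Binary.Permutation.Propositional using (_↭_; ↭-sym)
open import Data.List.Relation.Binary.Permutation.Propositional.Properties using (shift)
open import Data.List.Relation.Unary.All as All using (All; []; _∷_; all?)
open import Data.List.Relation.Unary.All.Properties using (++⁻ˡ; ++⁻ʳ; all-filter; ¬All⇒Any¬)
open import Data.List.Relation.Unary.Any as Any using (Any; here; there; any?)
import Data.List.Relation.Unary.Any.Properties as Anyₚ
open import Data.Product using (_×_; _,_; proj₁; proj₂)
open import Data.Sum as Sum using (_⊎_; inj₁; inj₂; [_,_]′)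
open import Data.Empty using (⊥-elim)
open import Data.Unit using (tt)
open import Function using (id; _∘_)
open import Relation.Binary.PropositionalEquality using (_≡_; refl; sym; trans; cong; cong₂; subst)
open import Relation.Nullary using (¬_; yes; no; does)
open import Relation.Nullary.Decidable using (dec-true; dec-false)
open import Relation.Unary using (Decidable)

variable
  Γ Γ' Δ Δ' E : List Form
  A R : List Prop
  α β : Form
  p : Prop

varsL-mono : Γ ⊆ Γ' → varsL Γ ⊆v varsL Γ'
varsL-mono sub = ∈-concatMap⁺ vars ∘ Any-resp-⊆ sub ∘ ∈-concatMap⁻ vars

Relevant : List Form → Form → Set
Relevant E φ = All (_∈ varsL E) (vars φ)

relevant? : (E : List Form) → Decidable (Relevant E)
relevant? E φ = all? (_∈? varsL E) (vars φ)

member-relevant : α ∈ E → Relevant E α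
member-relevant α∈E = All.tabulate (λ q∈α → ∈-concatMap⁺ vars (lose α∈E q∈α))

≋-refl : Γ ≋ Γ
≋-refl x = id , id

≋-trans : Γ ≋ Γ' → Γ' ≋ Δ → Γ ≋ Δ
≋-trans e f x = proj₁ (f x) ∘ proj₁ (e x) , proj₂ (e x) ∘ proj₂ (f x)

≋-cons : Γ ≋ Γ' → (α ∷ Γ) ≋ (α ∷ Γ')
≋-cons e x = (λ { (here q) → here q ; (there m) → there (proj₁ (e x) m) })
           , (λ { (here q) → here q ; (there m) → there (proj₂ (e x) m) })

↭⇒≋ : Γ ↭ Γ' → Γ ≋ Γ'
↭⇒≋ π x = ⊆-reflexive-↭ π , ⊆-reflexive-↭ (↭-sym π)

absorb : Γ' ⊆ Γ → Γ ≋ (Γ ++ Γ')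
absorb sub x = ∈-++⁺ˡ , [ id , sub ]′ ∘ ∈-++⁻ _

resp : H⊢ false Γ Δ → Γ' ≋ Γ → Δ' ≋ Δ → H⊢ false Γ' Δ'
resp (ax α e f) e' f' = ax α (≋-trans e' e) (≋-trans f' f)
resp (W⇒ {Γ = G} α d e) e' f' = W⇒ {Γ = G} α (resp d ≋-refl f') (≋-trans e' e)
resp (⇒W {Δ = D} α d f) e' f' = ⇒W {Δ = D} α (resp d e' ≋-refl) (≋-trans f' f)
resp (cut () _ _ _ _) _ _
resp (⇒¬ {Δ = D} α d f) e' f' = ⇒¬ {Δ = D} α (resp d (≋-cons e') ≋-refl) (≋-trans f' f)
resp (¬H⇒ α side d e) e' f' =
  ¬H⇒ α (varsL-mono (proj₂ (f' _)) ∘ side) (resp d ≋-refl (≋-cons f')) (≋-trans e' e)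
resp (∨⇒ α₁ α₂ d₁ d₂ e) e' f' = ∨⇒ α₁ α₂ (resp d₁ ≋-refl f') (resp d₂ ≋-refl f') (≋-trans e' e)
resp (⇒∨ α₁ α₂ d f) e' f' = ⇒∨ α₁ α₂ (resp d e' ≋-refl) (≋-trans f' f)

weaken : H⊢ false Γ Δ → Γ ⊆ Γ' → Δ ⊆ Δ' → H⊢ false Γ' Δ'
weaken {Γ' = Γ'} {Δ' = Δ'} d sub sub' =
  resp (weakenR Δ' (weakenL Γ' d)) (absorb sub) (absorb sub')
  where
  weakenL : ∀ {Γ Δ} X → H⊢ false Γ Δ → H⊢ false (X ++ Γ) Δ
  weakenL [] d = d
  weakenL (x ∷ X) d = W⇒ x (weakenL X d) ≋-refl
  weakenR : ∀ {Γ Δ} X → H⊢ false Γ Δ → H⊢ false Γ (X ++ Δ)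
  weakenR [] d = d
  weakenR (x ∷ X) d = ⇒W x (weakenR X d) ≋-refl

cutFree⇒H : ∀ {c} → H⊢ false Γ Δ → H⊢ c Γ Δ
cutFree⇒H (ax α e f) = ax α e f
cutFree⇒H (W⇒ α d e) = W⇒ α (cutFree⇒H d) e
cutFree⇒H (⇒W α d f) = ⇒W α (cutFree⇒H d) f
cutFree⇒H (cut () _ _ _ _)
cutFree⇒H (⇒¬ α d f) = ⇒¬ α (cutFree⇒H d) f
cutFree⇒H (¬H⇒ α side d e) = ¬H⇒ α side (cutFree⇒H d) e
cutFree⇒H (∨⇒ α₁ α₂ d₁ d₂ e) = ∨⇒ α₁ α₂ (cutFree⇒H d₁) (cutFree⇒H d₂) e
cutFree⇒H (⇒∨ α₁ α₂ d f) = ⇒∨ α₁ α₂ (cutFree⇒H d) f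

evalB : (Prop → Bool) → Form → Bool
evalB b (var p) = b p
evalB b (¬' φ) = not (evalB b φ)
evalB b (φ ∨' ψ) = evalB b φ ∨ evalB b ψ

toV : Bool → V
toV true = one
toV false = zero

toV-not : ∀ x → negV (toV x) ≡ toV (not x)
toV-not true = refl
toV-not false = refl

toV-∨ : ∀ x y → orV (toV x) (toV y) ≡ toV (x ∨ y)
toV-∨ true true = refl
toV-∨ true false = refl
toV-∨ false true = refl
toV-∨ false false = refl

eval-toV : ∀ {v b} φ → All (λ q → v q ≡ toV (b q)) (vars φ) → eval v φ ≡ toV (evalB b φ)
eval-toV (var p) (e ∷ []) = e
eval-toV {b = b} (¬' φ) agree = trans (cong negV (eval-toV {b = b} φ agree)) (toV-not (evalB b φ))
eval-toV {b = b} (φ ∨' ψ) agree =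
  trans (cong₂ orV (eval-toV {b = b} φ (++⁻ˡ (vars φ) agree))
                   (eval-toV {b = b} ψ (++⁻ʳ (vars φ) agree)))
        (toV-∨ (evalB b φ) (evalB b ψ))

-- ½ absorbs disjunction from the right (from the left it does so by definition).
orV-halfʳ : ∀ x → orV x half ≡ half
orV-halfʳ one = refl
orV-halfʳ half = refl
orV-halfʳ zero = refl

half-absorbing : ∀ {v} φ → Any (λ q → v q ≡ half) (vars φ) → eval v φ ≡ half
half-absorbing (var p) (here e) = e
half-absorbing (¬' φ) h = cong negV (half-absorbing φ h)
half-absorbing {v} (φ ∨' ψ) h with Anyₚ.++⁻ (vars φ) h
... | inj₁ hφ = cong (λ x → orV x (eval v ψ)) (half-absorbing φ hφ)
... | inj₂ hψ = trans (cong (orV (eval v φ)) (half-absorbing ψ hψ)) (orV-halfʳ _)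

size : Form → ℕ
size (var p) = 1
size (¬' φ) = suc (size φ)
size (φ ∨' ψ) = suc (size φ + size ψ)

sizeL : List Form → ℕ
sizeL [] = 0
sizeL (φ ∷ Γ) = size φ + sizeL Γ

measure : List Form → List Form → ℕ
measure Γ Δ = sizeL Γ + sizeL Δ

measure-move : ∀ α Γ Δ → measure Γ (α ∷ Δ) ≡ measure (α ∷ Γ) Δ
measure-move α Γ Δ = trans (sym (+-assoc (sizeL Γ) (size α) (sizeL Δ)))
                           (cong (_+ sizeL Δ) (+-comm (sizeL Γ) (size α)))

shrink-varL : ∀ p Γ Δ → measure Γ Δ < measure (var p ∷ Γ) Δ
shrink-varL p Γ Δ = ≤-refl

shrink-¬L : ∀ α Γ Δ → measure Γ (α ∷ Δ) < measure (¬' α ∷ Γ) Δ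
shrink-¬L α Γ Δ = s≤s (≤-reflexive (measure-move α Γ Δ))

shrink-∨L₁ : ∀ α β Γ Δ → measure (α ∷ Γ) Δ < measure (α ∨' β ∷ Γ) Δ
shrink-∨L₁ α β Γ Δ = s≤s (+-monoˡ-≤ (sizeL Δ) (+-monoˡ-≤ (sizeL Γ) (m≤m+n (size α) (size β))))

shrink-∨L₂ : ∀ α β Γ Δ → measure (β ∷ Γ) Δ < measure (α ∨' β ∷ Γ) Δ
shrink-∨L₂ α β Γ Δ = s≤s (+-monoˡ-≤ (sizeL Δ) (+-monoˡ-≤ (sizeL Γ) (m≤n+m (size β) (size α))))

shrink-varR : ∀ p Γ Δ → measure Γ Δ < measure Γ (var p ∷ Δ)
shrink-varR p Γ Δ = +-monoʳ-< (sizeL Γ) ≤-refl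

shrink-¬R : ∀ α Γ Δ → measure (α ∷ Γ) Δ < measure Γ (¬' α ∷ Δ)
shrink-¬R α Γ Δ = subst (_< measure Γ (¬' α ∷ Δ)) (measure-move α Γ Δ) (+-monoʳ-< (sizeL Γ) ≤-refl)

shrink-∨R : ∀ α β Γ Δ → measure Γ (α ∷ β ∷ Δ) < measure Γ (α ∨' β ∷ Δ)
shrink-∨R α β Γ Δ =
  +-monoʳ-< (sizeL Γ) (s≤s (≤-reflexive (sym (+-assoc (size α) (size β) (sizeL Δ)))))

descend : ∀ {m m' n} → m' < m → m < suc n → m' < n
descend shrink (s≤s bound) = <-≤-trans shrink bound

-- A classical countermodel to the sequent  Γ , A ⇒ Δ , R  whose atoms A, R
-- have already been separated from the unanalysed formulas Γ, Δ.
record Refutation (Γ : List Form) (A : List Prop) (Δ : List Form) (R : List Prop) : Set where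
  constructor refutes
  field
    val : Prop → Bool
    true-Γ : All (λ γ → evalB val γ ≡ true) Γ
    true-A : All (λ q → val q ≡ true) A
    false-Δ : All (λ δ → evalB val δ ≡ false) Δ
    false-R : All (λ q → val q ≡ false) R

module Search (E : List Form) where

  Outcome : List Form → List Prop → List Form → List Prop → Set
  Outcome Γ A Δ R =
    H⊢ false (Γ ++ map var A) (Δ ++ map var R ++ E) ⊎ Refutation Γ A Δ R

  -- Only atoms left: an atom on both sides gives an axiom; otherwise making
  -- exactly the atoms of A true refutes the sequent.
  atoms : ∀ A R → Outcome [] A [] R
  atoms A R with any? (_∈? R) A
  ... | yes shared with find shared
  ... | q , q∈A , q∈R =
    inj₁ (weaken (ax (var q) ≋-refl ≋-refl)
                 (λ { (here refl) → ∈-map⁺ var q∈A })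
                 (λ { (here refl) → ∈-++⁺ˡ (∈-map⁺ var q∈R) }))
  atoms A R | no disjoint =
    inj₂ (refutes (λ q → does (q ∈? A)) []
                  (All.tabulate (dec-true (_ ∈? A))) []
                  (All.tabulate (λ q∈R → dec-false (_ ∈? A) (λ q∈A → disjoint (lose q∈A q∈R)))))

  -- Each rule: derivations of the premises give one of the conclusion, and a
  -- refutation of a premise is one of the conclusion (invertibility).
  atomL : Outcome Γ (p ∷ A) Δ R → Outcome (var p ∷ Γ) A Δ R
  atomL {Γ} {p} {A} = Sum.map
    (λ d → resp d (↭⇒≋ (↭-sym (shift (var p) Γ (map var A)))) ≋-refl)
    (λ { (refutes b hΓ (h ∷ hA) fΔ fR) → refutes b (h ∷ hΓ) hA fΔ fR })

  negL : Relevant E α → Outcome Γ A (α ∷ Δ) R → Outcome (¬' α ∷ Γ) A Δ R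
  negL {α} {Δ = Δ} {R = R} rel = Sum.map
    (λ d → ¬H⇒ α (varsL-mono (∈-++⁺ʳ Δ ∘ ∈-++⁺ʳ (map var R)) ∘ All.lookup rel) d ≋-refl)
    (λ { (refutes b hΓ hA (f ∷ fΔ) fR) → refutes b (cong not f ∷ hΓ) hA fΔ fR })

  orL : Outcome (α ∷ Γ) A Δ R → Outcome (β ∷ Γ) A Δ R → Outcome (α ∨' β ∷ Γ) A Δ R
  orL {α} {β = β} (inj₁ d₁) (inj₁ d₂) = inj₁ (∨⇒ α β d₁ d₂ ≋-refl)
  orL {β = β} (inj₂ (refutes b (h ∷ hΓ) hA fΔ fR)) _ =
    inj₂ (refutes b (cong (_∨ evalB b β) h ∷ hΓ) hA fΔ fR)
  orL {α} (inj₁ _) (inj₂ (refutes b (h ∷ hΓ) hA fΔ fR)) =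
    inj₂ (refutes b (trans (cong (evalB b α ∨_) h) (∨-zeroʳ _) ∷ hΓ) hA fΔ fR)

  atomR : Outcome Γ A Δ (p ∷ R) → Outcome Γ A (var p ∷ Δ) R
  atomR {Δ = Δ} {p = p} {R = R} = Sum.map
    (λ d → resp d ≋-refl (↭⇒≋ (↭-sym (shift (var p) Δ (map var R ++ E)))))
    (λ { (refutes b hΓ hA fΔ (f ∷ fR)) → refutes b hΓ hA (f ∷ fΔ) fR })

  negR : Outcome (α ∷ Γ) A Δ R → Outcome Γ A (¬' α ∷ Δ) R
  negR {α} = Sum.map
    (λ d → ⇒¬ α d ≋-refl)
    (λ { (refutes b (h ∷ hΓ) hA fΔ fR) → refutes b hΓ hA (cong not h ∷ fΔ) fR })

  orR : Outcome Γ A (α ∷ β ∷ Δ) R → Outcome Γ A (α ∨' β ∷ Δ) R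
  orR {α = α} {β} = Sum.map
    (λ d → ⇒∨ α β d ≋-refl)
    (λ { (refutes b hΓ hA (f₁ ∷ f₂ ∷ fΔ) fR) → refutes b hΓ hA (cong₂ _∨_ f₁ f₂ ∷ fΔ) fR })

  -- Analyse the left side first, then the right side.  The fuel n exceeds the
  -- measure, and every formula met is relevant to E, which keeps (¬H⇒) applicable.
  search : ∀ n Γ A Δ R → measure Γ Δ < n →
           All (Relevant E) Γ → All (Relevant E) Δ → Outcome Γ A Δ R
  search zero _ _ _ _ () _ _
  search (suc n) [] A [] R _ _ _ = atoms A R
  search (suc n) (var p ∷ Γ) A Δ R bound (_ ∷ rΓ) rΔ =
    atomL (search n Γ (p ∷ A) Δ R (descend (shrink-varL p Γ Δ) bound) rΓ rΔ)
  search (suc n) (¬' α ∷ Γ) A Δ R bound (rα ∷ rΓ) rΔ =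
    negL rα (search n Γ A (α ∷ Δ) R (descend (shrink-¬L α Γ Δ) bound) rΓ (rα ∷ rΔ))
  search (suc n) (α ∨' β ∷ Γ) A Δ R bound (rαβ ∷ rΓ) rΔ =
    orL (search n (α ∷ Γ) A Δ R (descend (shrink-∨L₁ α β Γ Δ) bound) (++⁻ˡ (vars α) rαβ ∷ rΓ) rΔ)
        (search n (β ∷ Γ) A Δ R (descend (shrink-∨L₂ α β Γ Δ) bound) (++⁻ʳ (vars α) rαβ ∷ rΓ) rΔ)
  search (suc n) [] A (var p ∷ Δ) R bound _ (_ ∷ rΔ) =
    atomR (search n [] A Δ (p ∷ R) (descend (shrink-varR p [] Δ) bound) [] rΔ)
  search (suc n) [] A (¬' α ∷ Δ) R bound _ (rα ∷ rΔ) =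
    negR (search n (α ∷ []) A Δ R (descend (shrink-¬R α [] Δ) bound) (rα ∷ []) rΔ)
  search (suc n) [] A (α ∨' β ∷ Δ) R bound _ (rαβ ∷ rΔ) =
    orR (search n [] A (α ∷ β ∷ Δ) R (descend (shrink-∨R α β [] Δ) bound) []
                (++⁻ˡ (vars α) rαβ ∷ ++⁻ʳ (vars α) rαβ ∷ rΔ))

relevantPart : List Form → List Form → List Form
relevantPart Δ Γ = filter (relevant? Δ) Γ

extend : (Prop → Bool) → List Prop → Valuation
extend b W q with q ∈? W
... | yes _ = toV (b q)
... | no _ = half

extend-inside : ∀ b W {q} → q ∈ W → extend b W q ≡ toV (b q)
extend-inside b W {q} q∈W with q ∈? W
... | yes _ = refl
... | no q∉W = ⊥-elim (q∉W q∈W)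

extend-outside : ∀ b W {q} → ¬ q ∈ W → extend b W q ≡ half
extend-outside b W {q} q∉W with q ∈? W
... | yes q∈W = ⊥-elim (q∉W q∈W)
... | no _ = refl

extend-relevant : ∀ b Δ φ → Relevant Δ φ → eval (extend b (varsL Δ)) φ ≡ toV (evalB b φ)
extend-relevant b Δ φ rel = eval-toV φ (All.map (extend-inside b (varsL Δ)) rel)

refutation⇒invalid : ∀ b → All (λ γ → evalB b γ ≡ true) (relevantPart Δ Γ) →
                     All (λ δ → evalB b δ ≡ false) Δ → ¬ ValidSeq Γ Δ
refutation⇒invalid {Δ} {Γ} b true-Γ' false-Δ valid
  with valid v designated
  where
  v : Valuation
  v = extend b (varsL Δ)
  -- Relevant formulas of Γ get value 1, the others contain a variable valued ½.
  designated : ∀ {γ} → γ ∈ Γ → Designated (eval v γ)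
  designated {γ} γ∈Γ with relevant? Δ γ
  ... | yes rel = subst Designated (sym value-one) tt
    where
    value-one : eval v γ ≡ one
    value-one = trans (extend-relevant b Δ γ rel)
                      (cong toV (All.lookup true-Γ' (∈-filter⁺ (relevant? Δ) γ∈Γ rel)))
  ... | no irrel = subst Designated (sym (half-absorbing γ half-variable)) tt
    where
    half-variable : Any (λ q → v q ≡ half) (vars γ)
    half-variable = Any.map (extend-outside b (varsL Δ)) (¬All⇒Any¬ (_∈? varsL Δ) (vars γ) irrel)
-- The formulas of Δ get value 0.
... | δ , δ∈Δ , des =
  subst Designated (trans (extend-relevant b Δ δ (member-relevant δ∈Δ))
                          (cong toV (All.lookup false-Δ δ∈Δ))) des

cutFreeCompleteness : (Γ Δ : List Form) → ValidSeq Γ Δ → H⊢ false Γ Δ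
cutFreeCompleteness Γ Δ valid
  with Search.search Δ (suc (measure (relevantPart Δ Γ) Δ)) (relevantPart Δ Γ) [] Δ [] ≤-refl
                     (all-filter (relevant? Δ) Γ) (All.tabulate member-relevant)
... | inj₁ d = weaken d ([ proj₁ ∘ ∈-filter⁻ (relevant? Δ) , (λ ()) ]′ ∘ ∈-++⁻ _)
                        ([ id , id ]′ ∘ ∈-++⁻ Δ)
... | inj₂ (refutes b true-Γ' [] false-Δ []) = ⊥-elim (refutation⇒invalid b true-Γ' false-Δ valid)

mainTheorem2 : ((Γ Δ : List Form) → NonEmpty (Γ ++ Δ) → ValidSeq Γ Δ → H⊢ false Γ Δ)
    × ((Γ : List Form) (α : Form) → Conseq Γ α → H⊢ true Γ (α ∷ []))
mainTheorem2 = (λ Γ Δ _ → cutFreeCompleteness Γ Δ)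
             , (λ Γ α conseq → cutFree⇒H (cutFreeCompleteness Γ (α ∷ [])
                                 (λ v hyp → α , here refl , conseq v hyp)))
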